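{- Let $p\equiv5\pmod{12}$ be prime with $p=m^2+n^2$ for integers $m,n$, and let $b$ be a positive integer. Define integers $a_t$ ($t\in\mathbb{Z}$) by $Q(q^{bm},q^p)Q(q^{bn},q^p)=\sum_t a_tq^t$, and let $w$ be an integer with $2w\equiv m+n\pmod p$. Then for all integers $t$, \[ a_{pt+bw}\equiv a_{pt+b(w-3b)}\equiv0\pmod 2 . \]
   Context: For complex $z\neq0$ and $0<|q|<1$: $(z;q)_\infty=\prod_{j\ge0}(1-zq^j)$, $(a_1,\dots,a_j;q)_\infty=\prod_i(a_i;q)_\infty$, and the quintuple product is $Q(z,q)=(z,q/z,q;q)_\infty(qz^2,q/z^2;q^2)_\infty=\sum_{k\in\mathbb{Z}}q^{k(3k-1)/2}z^{3k}(1-zq^k)$; thus $Q(q^{bm},q^p)Q(q^{bn},q^p)$ is a Laurent series in $q$ with integer coefficients. -}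

module Defs where

open import Data.Nat as ℕ using (ℕ; zero; suc)
open import Data.Integer as ℤ using (ℤ; +_; _+_; _-_; _*_; -_; ∣_∣; _/ℕ_)
open import Data.Integer.Properties using (_≟_)
open import Data.List using (List; []; _∷_; map; upTo; concatMap; foldr)
open import Data.Bool using (if_then_else_)
open import Relation.Nullary.Decidable using (⌊_⌋)

-- The quintuple product, specialised:
--   Q(q^c, q^p) = Σ_{k∈ℤ} q^{p·k(3k-1)/2} (q^c)^{3k} (1 - q^c q^{p k})
--              = Σ_{k∈ℤ} Σ_{ε∈{0,1}} (-1)^ε q^{E p c k ε},
--   E p c k ε = p·k(3k-1)/2 + 3kc + ε(c + pk).

-- k(3k-1)/2 (always an integer; k(3k-1) is even, so the division is exact)
pent : ℤ → ℤ
pent k = (k * (+ 3 * k - + 1)) /ℕ 2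

expo : ℕ → ℤ → ℤ → ℕ → ℤ
expo p c k zero    = + p * pent k + + 3 * k * c
expo p c k (suc _) = + p * pent k + + 3 * k * c + (c + + p * k)

sgn : ℕ → ℤ
sgn zero    = + 1
sgn (suc _) = - + 1

sumℤ : List ℤ → ℤ
sumℤ = foldr _+_ (+ 0)

range : ℕ → List ℤ
range K = map (λ i → + i - + K) (upTo (suc (2 ℕ.* K)))

eps : List ℕ
eps = 0 ∷ 1 ∷ []

truncCoeff : ℕ → ℤ → ℤ → ℕ → ℤ → ℤ
truncCoeff p c₁ c₂ K t =
  sumℤ (concatMap (λ k → concatMap (λ l → concatMap (λ e → map (λ d →
        if ⌊ expo p c₁ k e + expo p c₂ l d ≟ t ⌋
          then sgn e * sgn d else + 0) eps) eps) (range K)) (range K))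

-- A window size that is large enough (for p ≥ 1): with Dᵢ = 3|cᵢ| + p one has
-- expo p c k ε ≥ k² - D|k| - |c|, so any (k,ε,l,δ) with exponent sum t has
-- |k|,|l| ≤ D₁ + D₂ + D₁² + D₂² + |c₁| + |c₂| + |t|.
bound : ℕ → ℤ → ℤ → ℤ → ℕ
bound p c₁ c₂ t =
  let D₁ = 3 ℕ.* ∣ c₁ ∣ ℕ.+ p
      D₂ = 3 ℕ.* ∣ c₂ ∣ ℕ.+ p
  in D₁ ℕ.+ D₂ ℕ.+ D₁ ℕ.* D₁ ℕ.+ D₂ ℕ.* D₂ ℕ.+ ∣ c₁ ∣ ℕ.+ ∣ c₂ ∣ ℕ.+ ∣ t ∣ ℕ.+ 1

-- a_t : the coefficient of q^t in Q(q^{c₁}, q^p) Q(q^{c₂}, q^p)  (for p ≥ 1)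
coeffQQ : ℕ → ℤ → ℤ → ℤ → ℤ
coeffQQ p c₁ c₂ t = truncCoeff p c₁ c₂ (bound p c₁ c₂ t) t

-- Writing u = 3k + ε and v = 3l + δ (ε, δ ∈ {0, 1}), the terms of Q(q^c₁, q^p) Q(q^c₂, q^p)
-- contributing to q^T are indexed by the points (u, v) with u, v ≢ 2 (mod 3) and
-- p (u(u - 1) + v(v - 1)) + 6 (c₁ u + c₂ v) = 6T, each with coefficient ±1.  So a_T is
-- congruent mod 2 to the number of these points, and it suffices to exhibit a fixed-point-free
-- involution of this finite set.  If p ∣ b, the reflection u ↦ 1 - u - 6(b/p)m does it for
-- every T.  Otherwise p ∤ 6b, and on the solutions for T = pt + bw (resp. T = pt + b(w - 3b))
-- p divides 2(mu + nv) - m - n (resp. the same plus 6b); since p = m² + n², this makes the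
-- reflection of (u, v) in the line through (½, ½) parallel to (m, n) (resp. in the line
-- 2(mu + nv) = m + n - 6b) integral, and it preserves the exponent.  The congruences
-- p ≡ 2 (mod 3) and p ≡ 1 (mod 2) keep the images away from u, v ≡ 2 (mod 3) and exclude
-- fixed points.

module Submission where

open import Defs
open import Data.Bool.Base using (if_then_else_)
open import Data.Empty using (⊥; ⊥-elim)
open import Data.Integer.Base as ℤ
  using (ℤ; +_; -[1+_]; 0ℤ; 1ℤ; _+_; _-_; _*_; -_; ∣_∣; _/ℕ_; _%ℕ_; +≤+)
import Data.Integer.Properties as ℤ
open import Data.Integer.DivMod using (n%ℕd<d; a≡a%ℕn+[a/ℕn]*n)
open import Data.Integer.Divisibility using (_∣_)
import Data.Integer.Divisibility.Signed as Signed
open import Data.Integer.Tactic.RingSolver using (solve-∀)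
open import Data.List.Base using (List; []; _∷_; _++_; map; filter; length; cartesianProduct; concatMap)
import Data.List.Properties as List
open import Data.List.Membership.Propositional using (_∈_; _∉_; _─_)
open import Data.List.Membership.Propositional.Properties
  using (∈-map⁺; ∈-upTo⁺; ∈-cartesianProduct⁺; ∈-cartesianProduct⁻; ∈-filter⁺; ∈-filter⁻)
open import Data.List.Relation.Unary.All as All using ([]; _∷_)
import Data.List.Relation.Unary.All.Properties as All
open import Data.List.Relation.Unary.Any using (here; there)
open import Data.List.Relation.Unary.AllPairs using ([]; _∷_)
open import Data.List.Relation.Unary.Unique.Propositional using (Unique)
import Data.List.Relation.Unary.Unique.Propositional.Properties as Unique
open import Data.Nat.Base as ℕ using (ℕ; zero; suc; z≤n; s≤s; _≤_; _<_; _%_)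
import Data.Nat.Properties as ℕ
import Data.Nat.DivMod as ℕ
open import Data.Nat.Divisibility as ℕ using (_∣?_)
open import Data.Nat.Primality using (Prime; euclidsLemma; prime⇒nonZero)
import Data.Nat.Tactic.RingSolver as ℕ-Ring
open import Data.Product.Base using (_×_; _,_; proj₁; proj₂)
open import Data.Product.Properties using (,-injectiveˡ)
open import Data.Sum.Base using (inj₁; inj₂; [_,_]′)
open import Function.Base using (_∘_)
open import Relation.Binary.PropositionalEquality
open import Relation.Nullary.Decidable
  using (Dec; yes; no; ⌊_⌋; from-yes; _→-dec_; _×-dec_; ¬?; map′; toSum)
open import Relation.Nullary.Negation using (¬_; contradiction)

regroup-multiple : ∀ {r₀ r} q₀ q D → r₀ + q₀ * D ≡ r + q * D → r₀ ≡ r + (q - q₀) * D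
regroup-multiple {r₀} {r} q₀ q D eq = begin
  r₀                    ≡⟨ cancel r₀ q₀ D ⟨
  r₀ + q₀ * D - q₀ * D  ≡⟨ cong (_- q₀ * D) eq ⟩
  r + q * D - q₀ * D    ≡⟨ collect r q q₀ D ⟩
  r + (q - q₀) * D      ∎
  where
  open ≡-Reasoning
  cancel : ∀ r₀ q₀ D → r₀ + q₀ * D - q₀ * D ≡ r₀
  cancel = solve-∀
  collect : ∀ r q q₀ D → r + q * D - q₀ * D ≡ r + (q - q₀) * D
  collect = solve-∀

-- A record rather than a function, so that a and b can be recovered by unification.
infix 4 _≡_[mod_]
record _≡_[mod_] (a b : ℤ) (d : ℕ) .{{_ : ℕ.NonZero d}} : Set where
  constructor mod
  field %ℕ-≡ : a %ℕ d ≡ b %ℕ d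

open _≡_[mod_] public

module _ (d : ℕ) .{{_ : ℕ.NonZero d}} where

  private
    multiple-exceeds : ∀ {r r′} s → r < d → + r ≢ + r′ + + suc s * + d
    multiple-exceeds {r} {r′} s r<d r≡ = ℕ.<⇒≱ r<d (begin
      d                   ≤⟨ ℕ.m≤m+n d (s ℕ.* d) ⟩
      suc s ℕ.* d         ≤⟨ ℕ.m≤n+m _ r′ ⟩
      r′ ℕ.+ suc s ℕ.* d  ≡⟨ ℤ.+-injective r≡′ ⟨
      r                   ∎)
      where
      open ℕ.≤-Reasoning
      r≡′ : + r ≡ + (r′ ℕ.+ suc s ℕ.* d)
      r≡′ = trans r≡ (sym (trans (ℤ.pos-+ r′ _) (cong (_+_ (+ r′)) (ℤ.pos-* (suc s) d))))

    quotient-difference-zero : ∀ {r r′} z → r < d → r′ < d → + r ≡ + r′ + z * + d → z ≡ 0ℤ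
    quotient-difference-zero (+ zero)  _   _    _  = refl
    quotient-difference-zero (+ suc s) r<d _    r≡ = ⊥-elim (multiple-exceeds s r<d r≡)
    quotient-difference-zero {r} {r′} -[1+ s ] _ r′<d r≡ = ⊥-elim (multiple-exceeds s r′<d
      (regroup-multiple {+ r′} {+ r} -[1+ s ] 0ℤ (+ d) (trans (sym r≡) (sym (ℤ.+-identityʳ (+ r))))))

  divMod-unique : ∀ {a r} q → r < d → a ≡ + r + q * + d → a %ℕ d ≡ r × a /ℕ d ≡ q
  divMod-unique {a} {r} q r<d a≡ = ℤ.+-injective r₀≡r , sym (ℤ.i-j≡0⇒i≡j q _ q-q₀≡0)
    where
    r₀≡ : + (a %ℕ d) ≡ + r + (q - a /ℕ d) * + d
    r₀≡ = regroup-multiple {r = + r} (a /ℕ d) q (+ d) (trans (sym (a≡a%ℕn+[a/ℕn]*n a d)) a≡)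
    q-q₀≡0 : q - a /ℕ d ≡ 0ℤ
    q-q₀≡0 = quotient-difference-zero _ (n%ℕd<d a d) r<d r₀≡
    r₀≡r : + (a %ℕ d) ≡ + r
    r₀≡r = trans r₀≡ (trans (cong (λ z → + r + z * + d) q-q₀≡0) (ℤ.+-identityʳ (+ r)))

  /ℕ-unique : ∀ {a} q → a ≡ q * + d → a /ℕ d ≡ q
  /ℕ-unique q a≡ = proj₂ (divMod-unique q (ℕ.>-nonZero⁻¹ d) (trans a≡ (sym (ℤ.+-identityˡ _))))

  /ℕ-exact : ∀ {a} → + d ∣ a → + d * (a /ℕ d) ≡ a
  /ℕ-exact {a} d∣a with Signed.divides q a≡ ← Signed.∣ᵤ⇒∣ d∣a = begin
    + d * (a /ℕ d)  ≡⟨ cong (+ d *_) (/ℕ-unique q a≡) ⟩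
    + d * q         ≡⟨ ℤ.*-comm (+ d) q ⟩
    q * + d         ≡⟨ a≡ ⟨
    a               ∎
    where open ≡-Reasoning

  %ℕ-reduce : ∀ {a} r q → a ≡ + r + q * + d → a %ℕ d ≡ r % d
  %ℕ-reduce {a} r q a≡ = proj₁ (divMod-unique (+ (r ℕ./ d) + q) (ℕ.m%n<n r d) (begin
    a                                        ≡⟨ a≡ ⟩
    + r + q * + d                            ≡⟨ cong (_+ q * + d) (a≡a%ℕn+[a/ℕn]*n (+ r) d) ⟩
    + (r % d) + + (r ℕ./ d) * + d + q * + d  ≡⟨ collect (+ (r % d)) (+ (r ℕ./ d)) q (+ d) ⟩
    + (r % d) + (+ (r ℕ./ d) + q) * + d      ∎))
    where
    open ≡-Reasoning
    collect : ∀ r₀ q₀ q D → r₀ + q₀ * D + q * D ≡ r₀ + (q₀ + q) * D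
    collect = solve-∀

  %ℕ≡0⇒∣ : ∀ {a} → a %ℕ d ≡ 0 → + d ∣ a
  %ℕ≡0⇒∣ {a} a%d≡0 = Signed.∣⇒∣ᵤ (Signed.divides (a /ℕ d) (begin
    a                            ≡⟨ a≡a%ℕn+[a/ℕn]*n a d ⟩
    + (a %ℕ d) + a /ℕ d * + d    ≡⟨ cong (λ r → + r + a /ℕ d * + d) a%d≡0 ⟩
    0ℤ + a /ℕ d * + d            ≡⟨ ℤ.+-identityˡ _ ⟩
    a /ℕ d * + d                 ∎))
    where open ≡-Reasoning

  %ℕ-distrib-+ : ∀ a b → (a + b) %ℕ d ≡ (a %ℕ d ℕ.+ b %ℕ d) % d
  %ℕ-distrib-+ a b = %ℕ-reduce (r ℕ.+ r′) (q + q′) (begin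
    a + b                             ≡⟨ cong₂ _+_ (a≡a%ℕn+[a/ℕn]*n a d) (a≡a%ℕn+[a/ℕn]*n b d) ⟩
    + r + q * + d + (+ r′ + q′ * + d) ≡⟨ collect (+ r) (+ r′) q q′ (+ d) ⟩
    + r + + r′ + (q + q′) * + d       ≡⟨ cong (_+ (q + q′) * + d) (ℤ.pos-+ r r′) ⟨
    + (r ℕ.+ r′) + (q + q′) * + d     ∎)
    where
    open ≡-Reasoning
    r = a %ℕ d
    r′ = b %ℕ d
    q = a /ℕ d
    q′ = b /ℕ d
    collect : ∀ r r′ q q′ D → r + q * D + (r′ + q′ * D) ≡ r + r′ + (q + q′) * D
    collect = solve-∀

  %ℕ-distrib-* : ∀ a b → (a * b) %ℕ d ≡ ((a %ℕ d) ℕ.* (b %ℕ d)) % d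
  %ℕ-distrib-* a b = %ℕ-reduce (r ℕ.* r′) quotient (begin
    a * b                                 ≡⟨ cong₂ _*_ (a≡a%ℕn+[a/ℕn]*n a d) (a≡a%ℕn+[a/ℕn]*n b d) ⟩
    (+ r + q * + d) * (+ r′ + q′ * + d)   ≡⟨ expand (+ r) (+ r′) q q′ (+ d) ⟩
    + r * + r′ + quotient * + d           ≡⟨ cong (_+ quotient * + d) (ℤ.pos-* r r′) ⟨
    + (r ℕ.* r′) + quotient * + d         ∎)
    where
    open ≡-Reasoning
    r = a %ℕ d
    r′ = b %ℕ d
    q = a /ℕ d
    q′ = b /ℕ d
    quotient = q * + r′ + + r * q′ + q * q′ * + d
    expand : ∀ r r′ q q′ D → (r + q * D) * (r′ + q′ * D) ≡ r * r′ + (q * r′ + r * q′ + q * q′ * D) * D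
    expand = solve-∀

module _ {d : ℕ} .{{_ : ℕ.NonZero d}} where

  mod-refl : ∀ a → a ≡ a [mod d ]
  mod-refl _ = mod refl

  mod-sym : ∀ {a b} → a ≡ b [mod d ] → b ≡ a [mod d ]
  mod-sym (mod eq) = mod (sym eq)

  mod-trans : ∀ {a b c} → a ≡ b [mod d ] → b ≡ c [mod d ] → a ≡ c [mod d ]
  mod-trans (mod eq₁) (mod eq₂) = mod (trans eq₁ eq₂)

  ≡⇒mod : ∀ {a b} → a ≡ b → a ≡ b [mod d ]
  ≡⇒mod a≡b = mod (cong (_%ℕ d) a≡b)

  mod-residue : ∀ a → a ≡ + (a %ℕ d) [mod d ]
  mod-residue a = mod (sym (ℕ.m<n⇒m%n≡m (n%ℕd<d a d)))

  mod-+ : ∀ {a a′ b b′} → a ≡ a′ [mod d ] → b ≡ b′ [mod d ] → a + b ≡ a′ + b′ [mod d ]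
  mod-+ {a} {a′} {b} {b′} (mod a≡a′) (mod b≡b′) = mod (begin
    (a + b) %ℕ d                ≡⟨ %ℕ-distrib-+ d a b ⟩
    (a %ℕ d ℕ.+ b %ℕ d) % d     ≡⟨ cong₂ (λ x y → (x ℕ.+ y) % d) a≡a′ b≡b′ ⟩
    (a′ %ℕ d ℕ.+ b′ %ℕ d) % d   ≡⟨ %ℕ-distrib-+ d a′ b′ ⟨
    (a′ + b′) %ℕ d              ∎)
    where open ≡-Reasoning

  mod-* : ∀ {a a′ b b′} → a ≡ a′ [mod d ] → b ≡ b′ [mod d ] → a * b ≡ a′ * b′ [mod d ]
  mod-* {a} {a′} {b} {b′} (mod a≡a′) (mod b≡b′) = mod (begin
    (a * b) %ℕ d                    ≡⟨ %ℕ-distrib-* d a b ⟩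
    ((a %ℕ d) ℕ.* (b %ℕ d)) % d     ≡⟨ cong₂ (λ x y → (x ℕ.* y) % d) a≡a′ b≡b′ ⟩
    ((a′ %ℕ d) ℕ.* (b′ %ℕ d)) % d   ≡⟨ %ℕ-distrib-* d a′ b′ ⟨
    (a′ * b′) %ℕ d                  ∎)
    where open ≡-Reasoning

  mod-+-multiple : ∀ a q → a + q * + d ≡ a [mod d ]
  mod-+-multiple a q = mod (trans (%ℕ-reduce d (a %ℕ d) (a /ℕ d + q) (begin
    a + q * + d                              ≡⟨ cong (_+ q * + d) (a≡a%ℕn+[a/ℕn]*n a d) ⟩
    + (a %ℕ d) + a /ℕ d * + d + q * + d      ≡⟨ collect (+ (a %ℕ d)) (a /ℕ d) q (+ d) ⟩
    + (a %ℕ d) + (a /ℕ d + q) * + d          ∎)) (ℕ.m<n⇒m%n≡m (n%ℕd<d a d)))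
    where
    open ≡-Reasoning
    collect : ∀ r q t D → r + q * D + t * D ≡ r + (q + t) * D
    collect = solve-∀

infix 4 _≟_[mod_]
_≟_[mod_] : ∀ a b d .{{_ : ℕ.NonZero d}} → Dec (a ≡ b [mod d ])
a ≟ b [mod d ] = map′ mod %ℕ-≡ (a %ℕ d ℕ.≟ b %ℕ d)

-- Fixed-point-free involutions

module _ {A : Set} where

  record FixedPointFreeInvolution (σ : A → A) (P : A → Set) : Set where
    field
      closed         : ∀ {x} → P x → P (σ x)
      involutive     : ∀ {x} → P x → σ (σ x) ≡ x
      no-fixed-point : ∀ {x} → P x → σ x ≢ x

  open FixedPointFreeInvolution

  private
    ∈-─⁻ : ∀ {x y} {xs : List A} (x∈xs : x ∈ xs) → y ∈ xs ─ x∈xs → y ∈ xs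
    ∈-─⁻ (here _)   y∈         = there y∈
    ∈-─⁻ (there _)  (here y≡)  = here y≡
    ∈-─⁻ (there x∈) (there y∈) = there (∈-─⁻ x∈ y∈)

    ∈-─⁺ : ∀ {x y} {xs : List A} (x∈xs : x ∈ xs) → y ∈ xs → y ≢ x → y ∈ xs ─ x∈xs
    ∈-─⁺ (here x≡)  (here y≡)  y≢x = ⊥-elim (y≢x (trans y≡ (sym x≡)))
    ∈-─⁺ (here _)   (there y∈) _   = y∈
    ∈-─⁺ (there _)  (here y≡)  _   = here y≡
    ∈-─⁺ (there x∈) (there y∈) y≢x = there (∈-─⁺ x∈ y∈ y≢x)

    ∉-─ : ∀ {x} {xs : List A} → Unique xs → (x∈xs : x ∈ xs) → x ∉ xs ─ x∈xs
    ∉-─ (z≢ ∷ _) (here refl) x∈        = All.lookup z≢ x∈ refl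
    ∉-─ (z≢ ∷ _) (there x∈)  (here x≡) = All.lookup z≢ x∈ (sym x≡)
    ∉-─ (_ ∷ u)  (there x∈)  (there x∈′) = ∉-─ u x∈ x∈′

    unique-─ : ∀ {x} {xs : List A} → Unique xs → (x∈xs : x ∈ xs) → Unique (xs ─ x∈xs)
    unique-─ (_ ∷ u)  (here _)   = u
    unique-─ (z≢ ∷ u) (there x∈) = All.─⁺ x∈ z≢ ∷ unique-─ u x∈

    partner∈ : ∀ {σ x rest} → FixedPointFreeInvolution σ (_∈ x ∷ rest) → σ x ∈ rest
    partner∈ inv with closed inv (here refl)
    ... | here σx≡x = ⊥-elim (no-fixed-point inv (here refl) σx≡x)
    ... | there σx∈ = σx∈

    without-pair : ∀ {σ x rest} → Unique (x ∷ rest) → (inv : FixedPointFreeInvolution σ (_∈ x ∷ rest)) →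
                   FixedPointFreeInvolution σ (_∈ rest ─ partner∈ inv)
    without-pair {σ} {x} {rest} (x≢ ∷ u) inv = record
      { closed         = closed′
      ; involutive     = λ y∈ → involutive inv (there (∈-─⁻ p y∈))
      ; no-fixed-point = λ y∈ → no-fixed-point inv (there (∈-─⁻ p y∈))
      }
      where
      p = partner∈ inv
      closed′ : ∀ {y} → y ∈ rest ─ p → σ y ∈ rest ─ p
      closed′ {y} y∈ with closed inv (there (∈-─⁻ p y∈))
      ... | here σy≡x = ⊥-elim (∉-─ u p (subst (_∈ rest ─ p) y≡σx y∈))
        where
        y≡σx : y ≡ σ x
        y≡σx = trans (sym (involutive inv (there (∈-─⁻ p y∈)))) (cong σ σy≡x)
      ... | there σy∈ = ∈-─⁺ p σy∈ σy≢σx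
        where
        σy≢σx : σ y ≢ σ x
        σy≢σx σy≡σx = All.lookup x≢ (∈-─⁻ p y∈)
          (trans (sym (involutive inv (here refl))) (trans (cong σ (sym σy≡σx)) (involutive inv (there (∈-─⁻ p y∈)))))

    even-length : ∀ n {σ xs} → length xs ≡ n → Unique xs → FixedPointFreeInvolution σ (_∈ xs) → 2 ℕ.∣ n
    even-length zero          {xs = []}         _    _ _   = ℕ.divides 0 refl
    even-length (suc zero)    {xs = _ ∷ []}     _    _ inv with () ← partner∈ inv
    even-length (suc (suc n)) {xs = x ∷ rest} len≡ u@(_ ∷ u′) inv with ℕ.divides q n≡q*2 ←
      even-length n (ℕ.suc-injective (trans (sym (List.length-removeAt′ rest _)) (ℕ.suc-injective len≡)))
                  (unique-─ u′ (partner∈ inv)) (without-pair u inv)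
      = ℕ.divides (suc q) (cong (suc ∘ suc) n≡q*2)

  involution⇒2∣length : ∀ {σ xs} → Unique xs → FixedPointFreeInvolution σ (_∈ xs) → 2 ℕ.∣ length xs
  involution⇒2∣length = even-length _ refl

pent-double : ∀ k → + 2 * pent k ≡ k * (+ 3 * k - 1ℤ)
pent-double k = /ℕ-exact 2 {x} (%ℕ≡0⇒∣ 2 {x} (trans (%ℕ-≡ x≡) (even (n%ℕd<d k 2))))
  where
  x = k * (+ 3 * k - 1ℤ)
  x≡ : x ≡ + (k %ℕ 2) * (+ 3 * + (k %ℕ 2) - 1ℤ) [mod 2 ]
  x≡ = mod-* (mod-residue k) (mod-+ (mod-* (mod-refl (+ 3)) (mod-residue k)) (mod-refl (- 1ℤ)))
  even : ∀ {r} → r < 2 → (+ r * (+ 3 * + r - 1ℤ)) %ℕ 2 ≡ 0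
  even = from-yes (ℕ.allUpTo? (λ r → (+ r * (+ 3 * + r - 1ℤ)) %ℕ 2 ℕ.≟ 0) 2)

index : ℤ → ℕ → ℤ
index k ε = + ε + k * + 3

six-expo : ∀ p c k ε → ε ≤ 1 →
           + 6 * expo p c k ε ≡ + p * (index k ε * (index k ε - 1ℤ)) + + 6 * (c * index k ε)
six-expo p c k zero _ = begin
  + 6 * (+ p * pent k + + 3 * k * c)                ≡⟨ split (+ p) (pent k) k c ⟩
  + 3 * + p * (+ 2 * pent k) + + 18 * (k * c)       ≡⟨ cong (λ x → + 3 * + p * x + + 18 * (k * c)) (pent-double k) ⟩
  + 3 * + p * (k * (+ 3 * k - 1ℤ)) + + 18 * (k * c) ≡⟨ merge (+ p) k c ⟩
  + p * (index k 0 * (index k 0 - 1ℤ)) + + 6 * (c * index k 0) ∎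
  where
  open ≡-Reasoning
  split : ∀ P x k c → + 6 * (P * x + + 3 * k * c) ≡ + 3 * P * (+ 2 * x) + + 18 * (k * c)
  split = solve-∀
  merge : ∀ P k c → + 3 * P * (k * (+ 3 * k - 1ℤ)) + + 18 * (k * c)
                  ≡ P * ((0ℤ + k * + 3) * (0ℤ + k * + 3 - 1ℤ)) + + 6 * (c * (0ℤ + k * + 3))
  merge = solve-∀
six-expo p c k (suc zero) _ = begin
  + 6 * (expo p c k 0 + (c + + p * k))      ≡⟨ ℤ.*-distribˡ-+ (+ 6) (expo p c k 0) _ ⟩
  + 6 * expo p c k 0 + + 6 * (c + + p * k)  ≡⟨ cong (_+ + 6 * (c + + p * k)) (six-expo p c k 0 z≤n) ⟩
  + p * (index k 0 * (index k 0 - 1ℤ)) + + 6 * (c * index k 0) + + 6 * (c + + p * k)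
                                            ≡⟨ shift (+ p) k c ⟩
  + p * (index k 1 * (index k 1 - 1ℤ)) + + 6 * (c * index k 1) ∎
  where
  open ≡-Reasoning
  shift : ∀ P k c → P * ((0ℤ + k * + 3) * (0ℤ + k * + 3 - 1ℤ)) + + 6 * (c * (0ℤ + k * + 3)) + + 6 * (c + P * k)
                  ≡ P * ((1ℤ + k * + 3) * (1ℤ + k * + 3 - 1ℤ)) + + 6 * (c * (1ℤ + k * + 3))
  shift = solve-∀
six-expo p c k (suc (suc _)) (s≤s ())

weight : ℕ → ℤ → ℤ → ℤ × ℤ → ℤ
weight p c₁ c₂ (u , v) = + p * (u * (u - 1ℤ) + v * (v - 1ℤ)) + + 6 * (c₁ * u + c₂ * v)

weight-index : ∀ p c₁ c₂ k l ε δ → ε ≤ 1 → δ ≤ 1 →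
               + 6 * (expo p c₁ k ε + expo p c₂ l δ) ≡ weight p c₁ c₂ (index k ε , index l δ)
weight-index p c₁ c₂ k l ε δ ε≤1 δ≤1 = begin
  + 6 * (expo p c₁ k ε + expo p c₂ l δ)      ≡⟨ ℤ.*-distribˡ-+ (+ 6) (expo p c₁ k ε) _ ⟩
  + 6 * expo p c₁ k ε + + 6 * expo p c₂ l δ  ≡⟨ cong₂ _+_ (six-expo p c₁ k ε ε≤1) (six-expo p c₂ l δ δ≤1) ⟩
  + p * (u * (u - 1ℤ)) + + 6 * (c₁ * u) + (+ p * (v * (v - 1ℤ)) + + 6 * (c₂ * v))
                                             ≡⟨ collect (+ p) c₁ c₂ u v ⟩
  weight p c₁ c₂ (u , v)                     ∎
  where
  open ≡-Reasoning
  u = index k ε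
  v = index l δ
  collect : ∀ P c₁ c₂ u v → P * (u * (u - 1ℤ)) + + 6 * (c₁ * u) + (P * (v * (v - 1ℤ)) + + 6 * (c₂ * v))
                          ≡ P * (u * (u - 1ℤ) + v * (v - 1ℤ)) + + 6 * (c₁ * u + c₂ * v)
  collect = solve-∀

-- Bounding the solutions

0≤i+∣i∣ : ∀ i → 0ℤ ℤ.≤ i + + ∣ i ∣
0≤i+∣i∣ (+ n)    = +≤+ z≤n
0≤i+∣i∣ -[1+ n ] = subst (0ℤ ℤ.≤_) (sym (ℤ.+-inverseˡ (+ suc n))) ℤ.≤-refl

private
  0≤+ : ∀ n → 0ℤ ℤ.≤ + n
  0≤+ _ = +≤+ z≤n

  0≤-* : ∀ {i j} → 0ℤ ℤ.≤ i → 0ℤ ℤ.≤ j → 0ℤ ℤ.≤ i * j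
  0≤-* {+ a} {+ b} _ _ = subst (0ℤ ℤ.≤_) (ℤ.pos-* a b) (0≤+ (a ℕ.* b))

  0≤ij+∣ij∣ : ∀ i j → 0ℤ ℤ.≤ i * j + + ∣ i ∣ * + ∣ j ∣
  0≤ij+∣ij∣ i j = subst (λ x → 0ℤ ℤ.≤ i * j + x) (trans (cong +_ (ℤ.abs-* i j)) (ℤ.pos-* ∣ i ∣ ∣ j ∣))
                        (0≤i+∣i∣ (i * j))

  0≤i[i-1] : ∀ i → 0ℤ ℤ.≤ i * (i - 1ℤ)
  0≤i[i-1] (+ zero)  = ℤ.≤-refl
  0≤i[i-1] (+ suc n) = subst (0ℤ ℤ.≤_) (expand (+ n)) (0≤-* (0≤+ (suc n)) (0≤+ n))
    where
    expand : ∀ n → (1ℤ + n) * n ≡ (1ℤ + n) * (1ℤ + n - 1ℤ)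
    expand = solve-∀
  0≤i[i-1] -[1+ n ]  = subst (0ℤ ℤ.≤_) (expand (+ n)) (0≤-* (0≤+ (suc n)) (0≤+ (suc (suc n))))
    where
    expand : ∀ n → (1ℤ + n) * (+ 2 + n) ≡ - (1ℤ + n) * (- (1ℤ + n) - 1ℤ)
    expand = solve-∀

  i*i≡∣i∣*∣i∣ : ∀ i → i * i ≡ + (∣ i ∣ ℕ.* ∣ i ∣)
  i*i≡∣i∣*∣i∣ (+ n)    = sym (ℤ.pos-* n n)
  i*i≡∣i∣*∣i∣ -[1+ n ] = sym (ℤ.pos-* (suc n) (suc n))

  0≤i*i : ∀ i → 0ℤ ℤ.≤ i * i
  0≤i*i i = subst (0ℤ ℤ.≤_) (sym (i*i≡∣i∣*∣i∣ i)) (0≤+ _)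

  i≤+∣i∣ : ∀ i → i ℤ.≤ + ∣ i ∣
  i≤+∣i∣ (+ n)    = ℤ.≤-refl
  i≤+∣i∣ -[1+ n ] = ℤ.-≤+

  ≤-+-nonneg : ∀ i {j} → 0ℤ ℤ.≤ j → i ℤ.≤ i + j
  ≤-+-nonneg i 0≤j = subst (ℤ._≤ i + _) (ℤ.+-identityʳ i) (ℤ.+-monoʳ-≤ i 0≤j)

  -- 2·expo p c k 0 - 2k² = (p - 1) k(3k - 1) + k(k - 1) + 6(kc + |k||c|): here p ≥ 1 is used.
  square≤expo₀ : ∀ p .{{_ : ℕ.NonZero p}} c k → k * k ℤ.≤ expo p c k 0 + + 3 * (+ ∣ k ∣ * + ∣ c ∣)
  square≤expo₀ p c k = ℤ.*-cancelˡ-≤-pos _ _ (+ 2) (ℤ.0≤i-j⇒j≤i (subst (0ℤ ℤ.≤_) (sym slack≡) 0≤slack))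
    where
    open ≡-Reasoning
    A = + ∣ k ∣
    G = + ∣ c ∣
    y = k * (+ 3 * k - 1ℤ)
    slack≡ : + 2 * (expo p c k 0 + + 3 * (A * G)) - + 2 * (k * k)
           ≡ (+ p - 1ℤ) * y + k * (k - 1ℤ) + + 6 * (k * c + A * G)
    slack≡ = begin
      + 2 * (+ p * pent k + + 3 * k * c + + 3 * (A * G)) - + 2 * (k * k) ≡⟨ regroup (+ p) (pent k) k c A G ⟩
      + p * (+ 2 * pent k) + + 6 * (k * c + A * G) - + 2 * (k * k)
        ≡⟨ cong (λ x → + p * x + + 6 * (k * c + A * G) - + 2 * (k * k)) (pent-double k) ⟩
      + p * y + + 6 * (k * c + A * G) - + 2 * (k * k)                    ≡⟨ split (+ p) k c A G ⟩
      (+ p - 1ℤ) * y + k * (k - 1ℤ) + + 6 * (k * c + A * G)              ∎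
      where
      regroup : ∀ P x k c A G → + 2 * (P * x + + 3 * k * c + + 3 * (A * G)) - + 2 * (k * k)
                              ≡ P * (+ 2 * x) + + 6 * (k * c + A * G) - + 2 * (k * k)
      regroup = solve-∀
      split : ∀ P k c A G → P * (k * (+ 3 * k - 1ℤ)) + + 6 * (k * c + A * G) - + 2 * (k * k)
                          ≡ (P - 1ℤ) * (k * (+ 3 * k - 1ℤ)) + k * (k - 1ℤ) + + 6 * (k * c + A * G)
      split = solve-∀
    0≤y : 0ℤ ℤ.≤ y
    0≤y = subst (0ℤ ℤ.≤_) (collect k) (ℤ.+-mono-≤ (0≤i[i-1] k) (0≤-* (0≤+ 2) (0≤i*i k)))
      where
      collect : ∀ k → k * (k - 1ℤ) + + 2 * (k * k) ≡ k * (+ 3 * k - 1ℤ)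
      collect = solve-∀
    0≤slack : 0ℤ ℤ.≤ (+ p - 1ℤ) * y + k * (k - 1ℤ) + + 6 * (k * c + A * G)
    0≤slack = ℤ.+-mono-≤ (ℤ.+-mono-≤ (0≤-* (ℤ.i≤j⇒0≤j-i (+≤+ (ℕ.>-nonZero⁻¹ p))) 0≤y) (0≤i[i-1] k))
                         (0≤-* (0≤+ 6) (0≤ij+∣ij∣ k c))

  expo₀≤expo : ∀ p c k ε → expo p c k 0 ℤ.≤ expo p c k ε + (+ p * + ∣ k ∣ + + ∣ c ∣)
  expo₀≤expo p c k zero    = ≤-+-nonneg _ (ℤ.+-mono-≤ (0≤-* (0≤+ p) (0≤+ ∣ k ∣)) (0≤+ ∣ c ∣))
  expo₀≤expo p c k (suc _) = subst (expo p c k 0 ℤ.≤_) (regroup (expo p c k 0) (+ p) k c (+ ∣ k ∣) (+ ∣ c ∣))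
    (≤-+-nonneg _ (ℤ.+-mono-≤ (0≤i+∣i∣ c) (0≤-* (0≤+ p) (0≤i+∣i∣ k))))
    where
    regroup : ∀ e P k c A G → e + ((c + G) + P * (k + A)) ≡ e + (c + P * k) + (P * A + G)
    regroup = solve-∀

expo-lower-bound : ∀ p .{{_ : ℕ.NonZero p}} c k ε →
                   k * k ℤ.≤ expo p c k ε + + ((3 ℕ.* ∣ c ∣ ℕ.+ p) ℕ.* ∣ k ∣ ℕ.+ ∣ c ∣)
expo-lower-bound p c k ε = begin
  k * k                                         ≤⟨ square≤expo₀ p c k ⟩
  expo p c k 0 + + 3 * (A * G)                  ≤⟨ ℤ.+-monoˡ-≤ (+ 3 * (A * G)) (expo₀≤expo p c k ε) ⟩
  expo p c k ε + (+ p * A + G) + + 3 * (A * G)  ≡⟨ collect (expo p c k ε) (+ p) A G ⟩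
  expo p c k ε + ((+ 3 * G + + p) * A + G)      ≡⟨ cong (_+_ (expo p c k ε)) linear ⟨
  expo p c k ε + + ((3 ℕ.* ∣ c ∣ ℕ.+ p) ℕ.* ∣ k ∣ ℕ.+ ∣ c ∣) ∎
  where
  open ℤ.≤-Reasoning
  A = + ∣ k ∣
  G = + ∣ c ∣
  collect : ∀ e P A G → e + (P * A + G) + + 3 * (A * G) ≡ e + ((+ 3 * G + P) * A + G)
  collect = solve-∀
  linear : + ((3 ℕ.* ∣ c ∣ ℕ.+ p) ℕ.* ∣ k ∣ ℕ.+ ∣ c ∣) ≡ (+ 3 * G + + p) * A + G
  linear = trans (ℤ.pos-+ _ ∣ c ∣) (cong (_+ G) (trans (ℤ.pos-* (3 ℕ.* ∣ c ∣ ℕ.+ p) ∣ k ∣)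
                 (cong (_* A) (trans (ℤ.pos-+ (3 ℕ.* ∣ c ∣) p) (cong (_+ + p) (ℤ.pos-* 3 ∣ c ∣))))))

private
  square≤linear⇒≤ : ∀ a D M → a ℕ.* a ≤ D ℕ.* a ℕ.+ M → a ≤ D ℕ.+ M
  square≤linear⇒≤ a D M aa≤ with a ℕ.≤? D ℕ.+ M
  ... | yes a≤ = a≤
  ... | no  a≰ = ⊥-elim (ℕ.<⇒≱ Da+M<aa aa≤)
    where
    open ℕ.≤-Reasoning
    D+M<a = ℕ.≰⇒> a≰
    Da+M<aa : D ℕ.* a ℕ.+ M < a ℕ.* a
    Da+M<aa = begin-strict
      D ℕ.* a ℕ.+ M  <⟨ ℕ.+-monoʳ-< (D ℕ.* a) (ℕ.≤-<-trans (ℕ.m≤n+m M D) D+M<a) ⟩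
      D ℕ.* a ℕ.+ a  ≡⟨ ℕ.+-comm (D ℕ.* a) a ⟩
      suc D ℕ.* a    ≤⟨ ℕ.*-monoˡ-≤ a (ℕ.≤-trans (s≤s (ℕ.m≤m+n D M)) D+M<a) ⟩
      a ℕ.* a        ∎

  linear≤square+square : ∀ D b → D ℕ.* b ≤ b ℕ.* b ℕ.+ D ℕ.* D
  linear≤square+square D b with ℕ.≤-total b D
  ... | inj₁ b≤D = ℕ.≤-trans (ℕ.*-monoʳ-≤ D b≤D) (ℕ.m≤n+m _ _)
  ... | inj₂ D≤b = ℕ.≤-trans (ℕ.*-monoˡ-≤ b D≤b) (ℕ.m≤m+n _ _)

  first-coordinate-bound : ∀ a b D₁ D₂ g₁ g₂ R →
    a ℕ.* a ℕ.+ b ℕ.* b ≤ R ℕ.+ (D₁ ℕ.* a ℕ.+ g₁) ℕ.+ (D₂ ℕ.* b ℕ.+ g₂) →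
    a ≤ D₁ ℕ.+ D₂ ℕ.+ D₁ ℕ.* D₁ ℕ.+ D₂ ℕ.* D₂ ℕ.+ g₁ ℕ.+ g₂ ℕ.+ R ℕ.+ 1
  first-coordinate-bound a b D₁ D₂ g₁ g₂ R squares≤ = begin
    a                                      ≤⟨ square≤linear⇒≤ a D₁ M (ℕ.+-cancelʳ-≤ (b ℕ.* b) _ _ aa+bb≤) ⟩
    D₁ ℕ.+ M                               ≤⟨ ℕ.m≤m+n (D₁ ℕ.+ M) (D₂ ℕ.+ D₁ ℕ.* D₁ ℕ.+ 1) ⟩
    D₁ ℕ.+ M ℕ.+ (D₂ ℕ.+ D₁ ℕ.* D₁ ℕ.+ 1)  ≡⟨ rearrange D₁ D₂ g₁ g₂ R ⟩
    D₁ ℕ.+ D₂ ℕ.+ D₁ ℕ.* D₁ ℕ.+ D₂ ℕ.* D₂ ℕ.+ g₁ ℕ.+ g₂ ℕ.+ R ℕ.+ 1 ∎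
    where
    open ℕ.≤-Reasoning
    M = R ℕ.+ g₁ ℕ.+ g₂ ℕ.+ D₂ ℕ.* D₂
    X₁ = D₁ ℕ.* a ℕ.+ g₁
    aa+bb≤ : a ℕ.* a ℕ.+ b ℕ.* b ≤ D₁ ℕ.* a ℕ.+ M ℕ.+ b ℕ.* b
    aa+bb≤ = begin
      a ℕ.* a ℕ.+ b ℕ.* b                          ≤⟨ squares≤ ⟩
      R ℕ.+ X₁ ℕ.+ (D₂ ℕ.* b ℕ.+ g₂)               ≤⟨ ℕ.+-monoʳ-≤ (R ℕ.+ X₁) (ℕ.+-monoˡ-≤ g₂ (linear≤square+square D₂ b)) ⟩
      R ℕ.+ X₁ ℕ.+ (b ℕ.* b ℕ.+ D₂ ℕ.* D₂ ℕ.+ g₂)  ≡⟨ collect R D₁ a g₁ b D₂ g₂ ⟩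
      D₁ ℕ.* a ℕ.+ M ℕ.+ b ℕ.* b                   ∎
      where
      collect : ∀ R D₁ a g₁ b D₂ g₂ → R ℕ.+ (D₁ ℕ.* a ℕ.+ g₁) ℕ.+ (b ℕ.* b ℕ.+ D₂ ℕ.* D₂ ℕ.+ g₂)
                                    ≡ D₁ ℕ.* a ℕ.+ (R ℕ.+ g₁ ℕ.+ g₂ ℕ.+ D₂ ℕ.* D₂) ℕ.+ b ℕ.* b
      collect = ℕ-Ring.solve-∀
    rearrange : ∀ D₁ D₂ g₁ g₂ R →
                D₁ ℕ.+ (R ℕ.+ g₁ ℕ.+ g₂ ℕ.+ D₂ ℕ.* D₂) ℕ.+ (D₂ ℕ.+ D₁ ℕ.* D₁ ℕ.+ 1)
                ≡ D₁ ℕ.+ D₂ ℕ.+ D₁ ℕ.* D₁ ℕ.+ D₂ ℕ.* D₂ ℕ.+ g₁ ℕ.+ g₂ ℕ.+ R ℕ.+ 1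
    rearrange = ℕ-Ring.solve-∀

solution-within-bound : ∀ p .{{_ : ℕ.NonZero p}} c₁ c₂ t k l ε δ → expo p c₁ k ε + expo p c₂ l δ ≡ t →
                        ∣ k ∣ ≤ bound p c₁ c₂ t × ∣ l ∣ ≤ bound p c₁ c₂ t
solution-within-bound p c₁ c₂ t k l ε δ exponent≡t =
  first-coordinate-bound a b D₁ D₂ g₁ g₂ R squares≤ ,
  subst (b ≤_) (swap D₁ D₂ g₁ g₂ R)
        (first-coordinate-bound b a D₂ D₁ g₂ g₁ R (subst₂ _≤_ (ℕ.+-comm (a ℕ.* a) _) (swap′ R X₁ X₂) squares≤))
  where
  a = ∣ k ∣
  b = ∣ l ∣
  g₁ = ∣ c₁ ∣
  g₂ = ∣ c₂ ∣
  R = ∣ t ∣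
  D₁ = 3 ℕ.* g₁ ℕ.+ p
  D₂ = 3 ℕ.* g₂ ℕ.+ p
  X₁ = D₁ ℕ.* a ℕ.+ g₁
  X₂ = D₂ ℕ.* b ℕ.+ g₂
  squaresℤ≤ : k * k + l * l ℤ.≤ + (R ℕ.+ X₁ ℕ.+ X₂)
  squaresℤ≤ = begin
    k * k + l * l                                ≤⟨ ℤ.+-mono-≤ (expo-lower-bound p c₁ k ε) (expo-lower-bound p c₂ l δ) ⟩
    expo p c₁ k ε + + X₁ + (expo p c₂ l δ + + X₂)  ≡⟨ regroup (expo p c₁ k ε) (expo p c₂ l δ) (+ X₁) (+ X₂) ⟩
    expo p c₁ k ε + expo p c₂ l δ + + X₁ + + X₂    ≡⟨ cong (λ s → s + + X₁ + + X₂) exponent≡t ⟩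
    t + + X₁ + + X₂                                ≤⟨ ℤ.+-monoˡ-≤ (+ X₂) (ℤ.+-monoˡ-≤ (+ X₁) (i≤+∣i∣ t)) ⟩
    + R + + X₁ + + X₂                              ≡⟨ cong (_+ + X₂) (ℤ.pos-+ R X₁) ⟨
    + (R ℕ.+ X₁) + + X₂                            ≡⟨ ℤ.pos-+ (R ℕ.+ X₁) X₂ ⟨
    + (R ℕ.+ X₁ ℕ.+ X₂)                            ∎
    where
    open ℤ.≤-Reasoning
    regroup : ∀ e₁ e₂ x₁ x₂ → e₁ + x₁ + (e₂ + x₂) ≡ e₁ + e₂ + x₁ + x₂
    regroup = solve-∀
  squares≤ : a ℕ.* a ℕ.+ b ℕ.* b ≤ R ℕ.+ X₁ ℕ.+ X₂
  squares≤ = ℤ.drop‿+≤+ (subst (ℤ._≤ + (R ℕ.+ X₁ ℕ.+ X₂))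
    (trans (cong₂ _+_ (i*i≡∣i∣*∣i∣ k) (i*i≡∣i∣*∣i∣ l)) (sym (ℤ.pos-+ (a ℕ.* a) (b ℕ.* b)))) squaresℤ≤)
  swap′ : ∀ R X₁ X₂ → R ℕ.+ X₁ ℕ.+ X₂ ≡ R ℕ.+ X₂ ℕ.+ X₁
  swap′ = ℕ-Ring.solve-∀
  swap : ∀ D₁ D₂ g₁ g₂ R → D₂ ℕ.+ D₁ ℕ.+ D₂ ℕ.* D₂ ℕ.+ D₁ ℕ.* D₁ ℕ.+ g₂ ℕ.+ g₁ ℕ.+ R ℕ.+ 1
                         ≡ D₁ ℕ.+ D₂ ℕ.+ D₁ ℕ.* D₁ ℕ.+ D₂ ℕ.* D₂ ℕ.+ g₁ ℕ.+ g₂ ℕ.+ R ℕ.+ 1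
  swap = ℕ-Ring.solve-∀

-- Parity of the coefficients

Admissible : ℤ → Set
Admissible u = u %ℕ 3 ≤ 1

IsSolution : ℕ → ℤ → ℤ → ℤ → ℤ × ℤ → Set
IsSolution p c₁ c₂ t (u , v) = Admissible u × Admissible v × weight p c₁ c₂ (u , v) ≡ + 6 * t

Index : Set
Index = ℤ × ℤ × ℕ × ℕ

box : ℕ → List Index
box K = cartesianProduct (range K) (cartesianProduct (range K) (cartesianProduct eps eps))

exponent : ℕ → ℤ → ℤ → Index → ℤ
exponent p c₁ c₂ (k , l , ε , δ) = expo p c₁ k ε + expo p c₂ l δ

term : ℕ → ℤ → ℤ → ℤ → Index → ℤ
term p c₁ c₂ t (k , l , ε , δ) = if ⌊ expo p c₁ k ε + expo p c₂ l δ ℤ.≟ t ⌋ then sgn ε * sgn δ else 0ℤ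

map-cartesianProduct : ∀ {A B C : Set} (f : A × B → C) xs ys →
                       map f (cartesianProduct xs ys) ≡ concatMap (λ x → map (λ y → f (x , y)) ys) xs
map-cartesianProduct f []       ys = refl
map-cartesianProduct f (x ∷ xs) ys =
  trans (List.map-++ f (map (x ,_) ys) _) (cong₂ _++_ (sym (List.map-∘ ys)) (map-cartesianProduct f xs ys))

truncCoeff≡sum-terms : ∀ p c₁ c₂ K t → truncCoeff p c₁ c₂ K t ≡ sumℤ (map (term p c₁ c₂ t) (box K))
truncCoeff≡sum-terms p c₁ c₂ K t = cong sumℤ (sym
  (trans (map-cartesianProduct f (range K) (cartesianProduct (range K) ε×δ)) (List.concatMap-cong (λ k →
   trans (map-cartesianProduct (λ r → f (k , r)) (range K) ε×δ) (List.concatMap-cong (λ l →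
   map-cartesianProduct (λ s → f (k , l , s)) eps eps) (range K))) (range K))))
  where
  f = term p c₁ c₂ t
  ε×δ = cartesianProduct eps eps

sgn≡1 : ∀ ε → sgn ε ≡ 1ℤ [mod 2 ]
sgn≡1 zero    = mod refl
sgn≡1 (suc _) = mod refl

module _ (p : ℕ) (c₁ c₂ t : ℤ) where

  solves? : (x : Index) → Dec (exponent p c₁ c₂ x ≡ t)
  solves? x = exponent p c₁ c₂ x ℤ.≟ t

  sum-terms≡count : ∀ xs → sumℤ (map (term p c₁ c₂ t) xs) ≡ + length (filter solves? xs) [mod 2 ]
  sum-terms≡count []                  = mod-refl 0ℤ
  -- abstracting over `solves? x` lets both `term p c₁ c₂ t x` and `filter` compute
  sum-terms≡count (x@(_ , _ , ε , δ) ∷ xs) with solves? x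
  ... | yes _ = mod-+ (mod-* (sgn≡1 ε) (sgn≡1 δ)) (sum-terms≡count xs)
  ... | no  _ = mod-trans (≡⇒mod (ℤ.+-identityˡ _)) (sum-terms≡count xs)

toIndex : ℤ × ℤ → Index
toIndex (u , v) = u /ℕ 3 , v /ℕ 3 , u %ℕ 3 , v %ℕ 3

fromIndex : Index → ℤ × ℤ
fromIndex (k , l , ε , δ) = index k ε , index l δ

fromIndex∘toIndex : ∀ x → fromIndex (toIndex x) ≡ x
fromIndex∘toIndex (u , v) = sym (cong₂ _,_ (a≡a%ℕn+[a/ℕn]*n u 3) (a≡a%ℕn+[a/ℕn]*n v 3))

index-divMod : ∀ k ε → ε ≤ 1 → index k ε %ℕ 3 ≡ ε × index k ε /ℕ 3 ≡ k
index-divMod k ε ε≤1 = divMod-unique 3 k (s≤s (ℕ.≤-trans ε≤1 (ℕ.n≤1+n 1))) refl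

toIndex∘fromIndex : ∀ k l {ε δ} → ε ≤ 1 → δ ≤ 1 → toIndex (fromIndex (k , l , ε , δ)) ≡ (k , l , ε , δ)
toIndex∘fromIndex k l ε≤1 δ≤1 =
  cong₂ _,_ (proj₂ k-divMod) (cong₂ _,_ (proj₂ l-divMod) (cong₂ _,_ (proj₁ k-divMod) (proj₁ l-divMod)))
  where
  k-divMod = index-divMod k _ ε≤1
  l-divMod = index-divMod l _ δ≤1

private
  range-unique : ∀ K → Unique (range K)
  range-unique K = Unique.map⁺ (λ {i} {j} eq →
    ℤ.+-injective (trans (sym (cancel (+ i) (+ K))) (trans (cong (_+ + K) eq) (cancel (+ j) (+ K)))))
    (Unique.upTo⁺ _)
    where
    cancel : ∀ i K → i - K + K ≡ i
    cancel = solve-∀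

  ∈-range : ∀ K {k} → ∣ k ∣ ≤ K → k ∈ range K
  ∈-range K {k} ∣k∣≤K = subst (_∈ range K) shift (∈-map⁺ (λ i → + i - + K) (∈-upTo⁺ (s≤s ∣k+K∣≤2K)))
    where
    shift : + ∣ k + + K ∣ - + K ≡ k
    shift = trans (cong (_- + K) (ℤ.0≤i⇒+∣i∣≡i (ℤ.≤-trans (0≤i+∣i∣ k) (ℤ.+-monoʳ-≤ k (+≤+ ∣k∣≤K)))))
                  (cancel k (+ K))
      where
      cancel : ∀ k K → k + K - K ≡ k
      cancel = solve-∀
    ∣k+K∣≤2K : ∣ k + + K ∣ ≤ 2 ℕ.* K
    ∣k+K∣≤2K = ℕ.≤-trans (ℤ.∣i+j∣≤∣i∣+∣j∣ k (+ K))
                         (subst (∣ k ∣ ℕ.+ K ≤_) (cong (K ℕ.+_) (sym (ℕ.+-identityʳ K))) (ℕ.+-monoˡ-≤ K ∣k∣≤K))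

  eps-unique : Unique eps
  eps-unique = ((λ ()) ∷ []) ∷ [] ∷ []

  ∈-eps : ∀ {ε} → ε ≤ 1 → ε ∈ eps
  ∈-eps z≤n       = here refl
  ∈-eps (s≤s z≤n) = there (here refl)

  eps-≤1 : ∀ {ε} → ε ∈ eps → ε ≤ 1
  eps-≤1 (here refl)         = z≤n
  eps-≤1 (there (here refl)) = s≤s z≤n

  box-unique : ∀ K → Unique (box K)
  box-unique K = Unique.cartesianProduct⁺ (range-unique K)
                   (Unique.cartesianProduct⁺ (range-unique K) (Unique.cartesianProduct⁺ eps-unique eps-unique))

  ∈-box : ∀ K {k l ε δ} → ∣ k ∣ ≤ K → ∣ l ∣ ≤ K → ε ≤ 1 → δ ≤ 1 → (k , l , ε , δ) ∈ box K
  ∈-box K k≤ l≤ ε≤ δ≤ = ∈-cartesianProduct⁺ (∈-range K k≤)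
                          (∈-cartesianProduct⁺ (∈-range K l≤) (∈-cartesianProduct⁺ (∈-eps ε≤) (∈-eps δ≤)))

  box-≤1 : ∀ K {k l ε δ} → (k , l , ε , δ) ∈ box K → ε ≤ 1 × δ ≤ 1
  box-≤1 K x∈ with _ , x∈′ ← ∈-cartesianProduct⁻ (range K) _ x∈
              with _ , x∈″ ← ∈-cartesianProduct⁻ (range K) _ x∈′
              with ε∈ , δ∈ ← ∈-cartesianProduct⁻ eps eps x∈″
    = eps-≤1 ε∈ , eps-≤1 δ∈

module _ (p : ℕ) .{{_ : ℕ.NonZero p}} (c₁ c₂ t : ℤ) where

  private
    K = bound p c₁ c₂ t
    S = filter (solves? p c₁ c₂ t) (box K)

    index-solution : ∀ {x} → x ∈ S → IsSolution p c₁ c₂ t (fromIndex x) × toIndex (fromIndex x) ≡ x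
    index-solution {k , l , ε , δ} x∈S with x∈box , x-solves ← ∈-filter⁻ (solves? p c₁ c₂ t) x∈S
                                       with ε≤1 , δ≤1 ← box-≤1 K x∈box =
      ( subst (_≤ 1) (sym (proj₁ (index-divMod k ε ε≤1))) ε≤1
      , subst (_≤ 1) (sym (proj₁ (index-divMod l δ δ≤1))) δ≤1
      , trans (sym (weight-index p c₁ c₂ k l ε δ ε≤1 δ≤1)) (cong (+ 6 *_) x-solves) )
      , toIndex∘fromIndex k l ε≤1 δ≤1

    solution-index : ∀ {y} → IsSolution p c₁ c₂ t y → toIndex y ∈ S
    solution-index {y@(u , v)} (u-adm , v-adm , weight≡) =
      ∈-filter⁺ (solves? p c₁ c₂ t) (∈-box K (proj₁ within) (proj₂ within) u-adm v-adm) solves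
      where
      solves : exponent p c₁ c₂ (toIndex y) ≡ t
      solves = ℤ.*-cancelˡ-≡ (+ 6) _ _ (begin
        + 6 * exponent p c₁ c₂ (toIndex y)      ≡⟨ weight-index p c₁ c₂ (u /ℕ 3) (v /ℕ 3) (u %ℕ 3) (v %ℕ 3) u-adm v-adm ⟩
        weight p c₁ c₂ (fromIndex (toIndex y))  ≡⟨ cong (weight p c₁ c₂) (fromIndex∘toIndex y) ⟩
        weight p c₁ c₂ y                        ≡⟨ weight≡ ⟩
        + 6 * t                                 ∎)
        where open ≡-Reasoning
      within = solution-within-bound p c₁ c₂ t (u /ℕ 3) (v /ℕ 3) (u %ℕ 3) (v %ℕ 3) solves

    lift : ∀ {σ} → FixedPointFreeInvolution σ (IsSolution p c₁ c₂ t) →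
           FixedPointFreeInvolution (toIndex ∘ σ ∘ fromIndex) (_∈ S)
    lift {σ} inv = record
      { closed         = λ x∈S → solution-index (closed (proj₁ (index-solution x∈S)))
      ; involutive     = λ {x} x∈S → begin
          toIndex (σ (fromIndex (toIndex (σ (fromIndex x))))) ≡⟨ cong (toIndex ∘ σ) (fromIndex∘toIndex _) ⟩
          toIndex (σ (σ (fromIndex x)))                       ≡⟨ cong toIndex (involutive (proj₁ (index-solution x∈S))) ⟩
          toIndex (fromIndex x)                               ≡⟨ proj₂ (index-solution x∈S) ⟩
          x                                                   ∎
      ; no-fixed-point = λ x∈S σ̂x≡x → no-fixed-point (proj₁ (index-solution x∈S))
          (trans (sym (fromIndex∘toIndex _)) (cong fromIndex σ̂x≡x))
      }
      where
      open ≡-Reasoning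
      open FixedPointFreeInvolution inv

  involution⇒2∣coeffQQ : ∀ {σ} → FixedPointFreeInvolution σ (IsSolution p c₁ c₂ t) → + 2 ∣ coeffQQ p c₁ c₂ t
  involution⇒2∣coeffQQ inv = %ℕ≡0⇒∣ 2 {coeffQQ p c₁ c₂ t} (begin
    coeffQQ p c₁ c₂ t %ℕ 2                    ≡⟨ cong (_%ℕ 2) (truncCoeff≡sum-terms p c₁ c₂ K t) ⟩
    sumℤ (map (term p c₁ c₂ t) (box K)) %ℕ 2  ≡⟨ %ℕ-≡ (sum-terms≡count p c₁ c₂ t (box K)) ⟩
    length S % 2                              ≡⟨ ℕ.n∣m⇒m%n≡0 _ 2 2∣|S| ⟩
    0                                         ∎)
    where
    open ≡-Reasoning
    2∣|S| = involution⇒2∣length (Unique.filter⁺ (solves? p c₁ c₂ t) (box-unique K)) (lift inv)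

-- Modulo 3, m² + n² ≡ 2 forces m² ≡ n² ≡ 1, so jm ≡ 1 + u - mn(2v - 1) ≢ u + 1 for u, v ∈ {0, 1}.
reflect∥-admissible : ∀ {j m n u v u′ v′} →
  m * m + n * n ≡ + 2 [mod 3 ] → (m * m + n * n) * j + m + n ≡ + 2 * (m * u + n * v) [mod 3 ] →
  u′ + u ≡ j * m + 1ℤ [mod 3 ] → v′ + v ≡ j * n + 1ℤ [mod 3 ] →
  Admissible u → Admissible v → Admissible u′ × Admissible v′
reflect∥-admissible {j} {m} {n} {u} {v} {u′} {v′} h₁ h₂ h₃ h₄ u-adm v-adm =
  check (n%ℕd<d j 3) (n%ℕd<d m 3) (n%ℕd<d n 3) (s≤s u-adm) (s≤s v-adm) (n%ℕd<d u′ 3) (n%ℕd<d v′ 3)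
        (mod-trans (mod-sym m²+n²≡) h₁)
        (mod-trans (mod-sym (mod-+ (mod-+ (mod-* m²+n²≡ (ρ j)) (ρ m)) (ρ n)))
                   (mod-trans h₂ (mod-* (mod-refl (+ 2)) (mod-+ (mod-* (ρ m) (ρ u)) (mod-* (ρ n) (ρ v))))))
        (mod-trans (mod-sym (mod-+ (ρ u′) (ρ u))) (mod-trans h₃ (mod-+ (mod-* (ρ j) (ρ m)) (mod-refl 1ℤ))))
        (mod-trans (mod-sym (mod-+ (ρ v′) (ρ v))) (mod-trans h₄ (mod-+ (mod-* (ρ j) (ρ n)) (mod-refl 1ℤ))))
  where
  ρ = mod-residue {3}
  m²+n²≡ = mod-+ (mod-* (ρ m) (ρ m)) (mod-* (ρ n) (ρ n))
  check : ∀ {j} → j < 3 → ∀ {m} → m < 3 → ∀ {n} → n < 3 → ∀ {u} → u < 2 → ∀ {v} → v < 2 →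
          ∀ {u′} → u′ < 3 → ∀ {v′} → v′ < 3 →
          + m * + m + + n * + n ≡ + 2 [mod 3 ] →
          (+ m * + m + + n * + n) * + j + + m + + n ≡ + 2 * (+ m * + u + + n * + v) [mod 3 ] →
          + u′ + + u ≡ + j * + m + 1ℤ [mod 3 ] → + v′ + + v ≡ + j * + n + 1ℤ [mod 3 ] →
          u′ ≤ 1 × v′ ≤ 1
  check = from-yes (ℕ.allUpTo? (λ j → ℕ.allUpTo? (λ m → ℕ.allUpTo? (λ n → ℕ.allUpTo? (λ u → ℕ.allUpTo? (λ v →
          ℕ.allUpTo? (λ u′ → ℕ.allUpTo? (λ v′ →
            (+ m * + m + + n * + n ≟ + 2 [mod 3 ]) →-dec
            ((+ m * + m + + n * + n) * + j + + m + + n ≟ + 2 * (+ m * + u + + n * + v) [mod 3 ]) →-dec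
            (+ u′ + + u ≟ + j * + m + 1ℤ [mod 3 ]) →-dec (+ v′ + + v ≟ + j * + n + 1ℤ [mod 3 ]) →-dec
            (u′ ℕ.≤? 1 ×-dec v′ ℕ.≤? 1)) 3) 3) 2) 2) 3) 3) 3)

reflect∥-no-fixed-point : ∀ {j m n u v} → m * m + n * n ≡ 1ℤ [mod 2 ] →
  u + u ≡ j * m + 1ℤ [mod 2 ] → v + v ≡ j * n + 1ℤ [mod 2 ] → ⊥
reflect∥-no-fixed-point {j} {m} {n} {u} {v} h₁ h₂ h₃ =
  check (n%ℕd<d j 2) (n%ℕd<d m 2) (n%ℕd<d n 2) (n%ℕd<d u 2) (n%ℕd<d v 2)
        (mod-trans (mod-sym (mod-+ (mod-* (ρ m) (ρ m)) (mod-* (ρ n) (ρ n)))) h₁)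
        (mod-trans (mod-sym (mod-+ (ρ u) (ρ u))) (mod-trans h₂ (mod-+ (mod-* (ρ j) (ρ m)) (mod-refl 1ℤ))))
        (mod-trans (mod-sym (mod-+ (ρ v) (ρ v))) (mod-trans h₃ (mod-+ (mod-* (ρ j) (ρ n)) (mod-refl 1ℤ))))
  where
  ρ = mod-residue {2}
  check : ∀ {j} → j < 2 → ∀ {m} → m < 2 → ∀ {n} → n < 2 → ∀ {u} → u < 2 → ∀ {v} → v < 2 →
          + m * + m + + n * + n ≡ 1ℤ [mod 2 ] →
          + u + + u ≡ + j * + m + 1ℤ [mod 2 ] → + v + + v ≡ + j * + n + 1ℤ [mod 2 ] → ⊥
  check = from-yes (ℕ.allUpTo? (λ j → ℕ.allUpTo? (λ m → ℕ.allUpTo? (λ n → ℕ.allUpTo? (λ u → ℕ.allUpTo? (λ v →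
            (+ m * + m + + n * + n ≟ 1ℤ [mod 2 ]) →-dec
            (+ u + + u ≟ + j * + m + 1ℤ [mod 2 ]) →-dec (+ v + + v ≟ + j * + n + 1ℤ [mod 2 ]) →-dec
            no (λ ())) 2) 2) 2) 2) 2)

reflect⊥-admissible : ∀ {j m n u v u′ v′} →
  m * m + n * n ≡ + 2 [mod 3 ] → (m * m + n * n) * j + m + n ≡ + 2 * (m * u + n * v) [mod 3 ] →
  u′ + j * m ≡ u [mod 3 ] → v′ + j * n ≡ v [mod 3 ] →
  Admissible u → Admissible v → Admissible u′ × Admissible v′
reflect⊥-admissible {j} {m} {n} {u} {v} {u′} {v′} h₁ h₂ h₃ h₄ u-adm v-adm =
  check (n%ℕd<d j 3) (n%ℕd<d m 3) (n%ℕd<d n 3) (s≤s u-adm) (s≤s v-adm) (n%ℕd<d u′ 3) (n%ℕd<d v′ 3)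
        (mod-trans (mod-sym m²+n²≡) h₁)
        (mod-trans (mod-sym (mod-+ (mod-+ (mod-* m²+n²≡ (ρ j)) (ρ m)) (ρ n)))
                   (mod-trans h₂ (mod-* (mod-refl (+ 2)) (mod-+ (mod-* (ρ m) (ρ u)) (mod-* (ρ n) (ρ v))))))
        (mod-trans (mod-sym (mod-+ (ρ u′) (mod-* (ρ j) (ρ m)))) (mod-trans h₃ (ρ u)))
        (mod-trans (mod-sym (mod-+ (ρ v′) (mod-* (ρ j) (ρ n)))) (mod-trans h₄ (ρ v)))
  where
  ρ = mod-residue {3}
  m²+n²≡ = mod-+ (mod-* (ρ m) (ρ m)) (mod-* (ρ n) (ρ n))
  check : ∀ {j} → j < 3 → ∀ {m} → m < 3 → ∀ {n} → n < 3 → ∀ {u} → u < 2 → ∀ {v} → v < 2 →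
          ∀ {u′} → u′ < 3 → ∀ {v′} → v′ < 3 →
          + m * + m + + n * + n ≡ + 2 [mod 3 ] →
          (+ m * + m + + n * + n) * + j + + m + + n ≡ + 2 * (+ m * + u + + n * + v) [mod 3 ] →
          + u′ + + j * + m ≡ + u [mod 3 ] → + v′ + + j * + n ≡ + v [mod 3 ] →
          u′ ≤ 1 × v′ ≤ 1
  check = from-yes (ℕ.allUpTo? (λ j → ℕ.allUpTo? (λ m → ℕ.allUpTo? (λ n → ℕ.allUpTo? (λ u → ℕ.allUpTo? (λ v →
          ℕ.allUpTo? (λ u′ → ℕ.allUpTo? (λ v′ →
            (+ m * + m + + n * + n ≟ + 2 [mod 3 ]) →-dec
            ((+ m * + m + + n * + n) * + j + + m + + n ≟ + 2 * (+ m * + u + + n * + v) [mod 3 ]) →-dec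
            (+ u′ + + j * + m ≟ + u [mod 3 ]) →-dec (+ v′ + + j * + n ≟ + v [mod 3 ]) →-dec
            (u′ ℕ.≤? 1 ×-dec v′ ℕ.≤? 1)) 3) 3) 2) 2) 3) 3) 3)

reflect⊥-no-fixed-point : ∀ {j m n} → m * m + n * n ≡ 1ℤ [mod 2 ] →
  (m * m + n * n) * j + m + n ≡ 0ℤ [mod 2 ] → j * m ≡ 0ℤ [mod 2 ] → j * n ≡ 0ℤ [mod 2 ] → ⊥
reflect⊥-no-fixed-point {j} {m} {n} h₁ h₂ h₃ h₄ =
  check (n%ℕd<d j 2) (n%ℕd<d m 2) (n%ℕd<d n 2)
        (mod-trans (mod-sym m²+n²≡) h₁)
        (mod-trans (mod-sym (mod-+ (mod-+ (mod-* m²+n²≡ (ρ j)) (ρ m)) (ρ n))) h₂)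
        (mod-trans (mod-sym (mod-* (ρ j) (ρ m))) h₃)
        (mod-trans (mod-sym (mod-* (ρ j) (ρ n))) h₄)
  where
  ρ = mod-residue {2}
  m²+n²≡ = mod-+ (mod-* (ρ m) (ρ m)) (mod-* (ρ n) (ρ n))
  check : ∀ {j} → j < 2 → ∀ {m} → m < 2 → ∀ {n} → n < 2 →
          + m * + m + + n * + n ≡ 1ℤ [mod 2 ] → (+ m * + m + + n * + n) * + j + + m + + n ≡ 0ℤ [mod 2 ] →
          + j * + m ≡ 0ℤ [mod 2 ] → + j * + n ≡ 0ℤ [mod 2 ] → ⊥
  check = from-yes (ℕ.allUpTo? (λ j → ℕ.allUpTo? (λ m → ℕ.allUpTo? (λ n →
            (+ m * + m + + n * + n ≟ 1ℤ [mod 2 ]) →-dec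
            ((+ m * + m + + n * + n) * + j + + m + + n ≟ 0ℤ [mod 2 ]) →-dec
            (+ j * + m ≟ 0ℤ [mod 2 ]) →-dec (+ j * + n ≟ 0ℤ [mod 2 ]) →-dec
            no (λ ())) 2) 2) 2)

reflect-first-admissible : ∀ {u u′} → u′ + u ≡ 1ℤ [mod 3 ] → Admissible u → Admissible u′
reflect-first-admissible {u} {u′} h u-adm =
  check (s≤s u-adm) (n%ℕd<d u′ 3) (mod-trans (mod-sym (mod-+ (mod-residue u′) (mod-residue u))) h)
  where
  check : ∀ {u} → u < 2 → ∀ {u′} → u′ < 3 → + u′ + + u ≡ 1ℤ [mod 3 ] → u′ ≤ 1
  check = from-yes (ℕ.allUpTo? (λ u → ℕ.allUpTo? (λ u′ → (+ u′ + + u ≟ 1ℤ [mod 3 ]) →-dec u′ ℕ.≤? 1) 3) 2)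

u+u≢1[mod2] : ∀ u → ¬ (u + u ≡ 1ℤ [mod 2 ])
u+u≢1[mod2] u h = check (n%ℕd<d u 2) (mod-trans (mod-sym (mod-+ (mod-residue u) (mod-residue u))) h)
  where
  check : ∀ {u} → u < 2 → ¬ (+ u + + u ≡ 1ℤ [mod 2 ])
  check = from-yes (ℕ.allUpTo? (λ u → ¬? (+ u + + u ≟ 1ℤ [mod 2 ])) 2)

-- The three reflections

reflect-first : ℤ → ℤ × ℤ → ℤ × ℤ
reflect-first s (u , v) = 1ℤ - u - s , v

reflect-first-involution : ∀ p b′ m n t →
  FixedPointFreeInvolution (reflect-first (+ 6 * (+ b′ * m)))
                           (IsSolution p (+ (b′ ℕ.* p) * m) (+ (b′ ℕ.* p) * n) t)
reflect-first-involution p b′ m n t =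
  record { closed = closed ; involutive = involutive ; no-fixed-point = no-fixed-point }
  where
  y = + b′ * m
  s = + 6 * y
  C = + (b′ ℕ.* p)

  weight≡ : ∀ u v → weight p (C * m) (C * n) (1ℤ - u - s , v) ≡ weight p (C * m) (C * n) (u , v)
  weight≡ u v = subst (λ c → weight p (c * m) (c * n) (1ℤ - u - s , v) ≡ weight p (c * m) (c * n) (u , v))
                      (sym (ℤ.pos-* b′ p)) (identity (+ p) (+ b′) m n u v)
    where
    identity : ∀ P B m n u v →
      P * ((1ℤ - u - + 6 * (B * m)) * (1ℤ - u - + 6 * (B * m) - 1ℤ) + v * (v - 1ℤ))
        + + 6 * (B * P * m * (1ℤ - u - + 6 * (B * m)) + B * P * n * v)
      ≡ P * (u * (u - 1ℤ) + v * (v - 1ℤ)) + + 6 * (B * P * m * u + B * P * n * v)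
    identity = solve-∀

  closed : ∀ {x} → IsSolution p (C * m) (C * n) t x → IsSolution p (C * m) (C * n) t (reflect-first s x)
  closed {u , v} (u-adm , v-adm , weight≡t) =
    reflect-first-admissible {u} {1ℤ - u - s} (mod-trans (≡⇒mod (sum≡ u y)) (mod-+-multiple 1ℤ (- (+ 2 * y)))) u-adm ,
    v-adm , trans (weight≡ u v) weight≡t
    where
    sum≡ : ∀ u y → 1ℤ - u - + 6 * y + u ≡ 1ℤ + (- (+ 2 * y)) * + 3
    sum≡ = solve-∀

  involutive : ∀ {x} → IsSolution p (C * m) (C * n) t x → reflect-first s (reflect-first s x) ≡ x
  involutive {u , v} _ = cong (_, v) (cancel u s)
    where
    cancel : ∀ u s → 1ℤ - (1ℤ - u - s) - s ≡ u
    cancel = solve-∀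

  no-fixed-point : ∀ {x} → IsSolution p (C * m) (C * n) t x → reflect-first s x ≢ x
  no-fixed-point {u , v} _ x′≡x = u+u≢1[mod2] u (mod-trans
    (≡⇒mod (trans (cong (_+ u) (sym (,-injectiveˡ x′≡x))) (sum≡ u y))) (mod-+-multiple 1ℤ (- (+ 3 * y))))
    where
    sum≡ : ∀ u y → 1ℤ - u - + 6 * y + u ≡ 1ℤ + (- (+ 3 * y)) * + 2
    sum≡ = solve-∀

p∣b⇒2∣coeffQQ : ∀ p .{{_ : ℕ.NonZero p}} {b} → p ℕ.∣ b → ∀ m n t → + 2 ∣ coeffQQ p (+ b * m) (+ b * n) t
p∣b⇒2∣coeffQQ p (ℕ.divides b′ refl) m n t =
  involution⇒2∣coeffQQ p (+ (b′ ℕ.* p) * m) (+ (b′ ℕ.* p) * n) t (reflect-first-involution p b′ m n t)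

module _ (p : ℕ) .{{_ : ℕ.NonZero p}} (m n : ℤ) where

  numerator : ℤ → ℤ × ℤ → ℤ
  numerator s (u , v) = + 2 * (m * u + n * v) - m - n + s

  slope : ℤ → ℤ × ℤ → ℤ
  slope s x = numerator s x /ℕ p

  -- the reflection in the line through (½, ½) parallel to (m, n)
  reflect∥ : ℤ × ℤ → ℤ × ℤ
  reflect∥ x@(u , v) = slope 0ℤ x * m + 1ℤ - u , slope 0ℤ x * n + 1ℤ - v

  -- the reflection in the line 2(mu + nv) = m + n - 6b, perpendicular to (m, n)
  reflect⊥ : ℕ → ℤ × ℤ → ℤ × ℤ
  reflect⊥ b x@(u , v) = u - slope (+ 6 * + b) x * m , v - slope (+ 6 * + b) x * n

prime∣*⇒∣ : ∀ {p a} z → Prime p → ¬ p ℕ.∣ a → + p ∣ + a * z → + p ∣ z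
prime∣*⇒∣ {p} {a} z p-prime p∤a p∣az with euclidsLemma a ∣ z ∣ p-prime (subst (p ℕ.∣_) (ℤ.abs-* (+ a) z) p∣az)
... | inj₁ p∣a = contradiction p∣a p∤a
... | inj₂ p∣z = p∣z

p%12≡5⇒p%3≡2 : ∀ {p} → p % 12 ≡ 5 → p % 3 ≡ 2
p%12≡5⇒p%3≡2 {p} p%12≡5 = trans (sym (ℕ.m∣n⇒o%n%m≡o%m 3 12 p (ℕ.divides 4 refl))) (cong (_% 3) p%12≡5)

p%12≡5⇒p%2≡1 : ∀ {p} → p % 12 ≡ 5 → p % 2 ≡ 1
p%12≡5⇒p%2≡1 {p} p%12≡5 = trans (sym (ℕ.m∣n⇒o%n%m≡o%m 2 12 p (ℕ.divides 6 refl))) (cong (_% 2) p%12≡5)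

p%12≡5⇒p∤6 : ∀ {p} → p % 12 ≡ 5 → ¬ p ℕ.∣ 6
p%12≡5⇒p∤6 p%12≡5 p∣6 = check (s≤s (ℕ.∣⇒≤ p∣6)) p%12≡5 p∣6
  where
  check : ∀ {p} → p < 7 → p % 12 ≡ 5 → ¬ p ℕ.∣ 6
  check = from-yes (ℕ.allUpTo? (λ p → (p % 12 ℕ.≟ 5) →-dec ¬? (p ∣? 6)) 7)

module _ {p : ℕ} .{{_ : ℕ.NonZero p}} (p-prime : Prime p) (p%12≡5 : p % 12 ≡ 5)
         {m n : ℤ} (p≡m²+n² : + p ≡ m * m + n * n)
         {b : ℕ} (p∤b : ¬ p ℕ.∣ b) {w : ℤ} (p∣2w-m-n : + p ∣ + 2 * w - (m + n)) (t : ℤ) where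

  private
    B = + b

    Solution : ℤ → ℤ × ℤ → Set
    Solution W = IsSolution p (B * m) (B * n) (+ p * t + B * W)

    m²+n²≡2 : m * m + n * n ≡ + 2 [mod 3 ]
    m²+n²≡2 = mod-trans (≡⇒mod (sym p≡m²+n²)) (mod (p%12≡5⇒p%3≡2 {p} p%12≡5))

    m²+n²≡1 : m * m + n * n ≡ 1ℤ [mod 2 ]
    m²+n²≡1 = mod-trans (≡⇒mod (sym p≡m²+n²)) (mod (p%12≡5⇒p%2≡1 {p} p%12≡5))

    p∤6b : ¬ p ℕ.∣ 6 ℕ.* b
    p∤6b p∣6b with euclidsLemma 6 b p-prime p∣6b
    ... | inj₁ p∣6 = p%12≡5⇒p∤6 p%12≡5 p∣6
    ... | inj₂ p∣b = p∤b p∣b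

    -- on a solution, 6b(mu + nv - W) = p(6t - u(u - 1) - v(v - 1))
    p∣mu+nv-W : ∀ {W u v} → Solution W (u , v) → + p ∣ m * u + n * v - W
    p∣mu+nv-W {W} {u} {v} (_ , _ , weight≡) =
      prime∣*⇒∣ _ p-prime p∤6b (Signed.∣⇒∣ᵤ (Signed.divides (+ 6 * t - Q) (begin
        + (6 ℕ.* b) * (m * u + n * v - W)                    ≡⟨ cong (_* (m * u + n * v - W)) (ℤ.pos-* 6 b) ⟩
        + 6 * B * (m * u + n * v - W)                        ≡⟨ identity (+ p) B m n u v t W ⟩
        (+ 6 * t - Q) * + p + (weight p (B * m) (B * n) (u , v) - + 6 * (+ p * t + B * W))
                                                             ≡⟨ cong (_+_ ((+ 6 * t - Q) * + p)) (ℤ.i≡j⇒i-j≡0 weight≡) ⟩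
        (+ 6 * t - Q) * + p + 0ℤ                             ≡⟨ ℤ.+-identityʳ _ ⟩
        (+ 6 * t - Q) * + p                                  ∎)))
      where
      open ≡-Reasoning
      Q = u * (u - 1ℤ) + v * (v - 1ℤ)
      identity : ∀ P B m n u v t W → + 6 * B * (m * u + n * v - W)
        ≡ (+ 6 * t - (u * (u - 1ℤ) + v * (v - 1ℤ))) * P
          + ((P * (u * (u - 1ℤ) + v * (v - 1ℤ)) + + 6 * (B * m * u + B * n * v)) - + 6 * (P * t + B * W))
      identity = solve-∀

    slope-exact : ∀ {s W u v} → numerator p m n s (u , v) ≡ + 2 * (m * u + n * v - W) + (+ 2 * w - (m + n)) →
                  Solution W (u , v) → + p * slope p m n s (u , v) ≡ numerator p m n s (u , v)
    slope-exact {s} {W} {u} {v} numerator≡ sol = /ℕ-exact p {numerator p m n s (u , v)}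
      (subst (+ p ∣_) (sym numerator≡) (Signed.∣⇒∣ᵤ (Signed.∣m∣n⇒∣m+n
        (Signed.∣n⇒∣m*n (+ 2) (Signed.∣ᵤ⇒∣ {+ p} {m * u + n * v - W} (p∣mu+nv-W sol)))
        (Signed.∣ᵤ⇒∣ {+ p} {+ 2 * w - (m + n)} p∣2w-m-n))))

    vanish : ∀ {j N} → + p * j ≡ N → j * (m * m + n * n) - N ≡ 0ℤ
    vanish {j} {N} pj≡N = trans (cong (λ S → j * S - N) (sym p≡m²+n²))
                                (ℤ.i≡j⇒i-j≡0 (trans (ℤ.*-comm j (+ p)) pj≡N))

    slope-relation : ∀ {s u v j} → + p * j ≡ numerator p m n s (u , v) →
                     (m * m + n * n) * j + m + n ≡ + 2 * (m * u + n * v) + s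
    slope-relation {s} {u} {v} {j} pj≡N = begin
      (m * m + n * n) * j + m + n        ≡⟨ cong (λ S → S * j + m + n) (sym p≡m²+n²) ⟩
      + p * j + m + n                    ≡⟨ cong (λ z → z + m + n) pj≡N ⟩
      numerator p m n s (u , v) + m + n  ≡⟨ cancel m n u v s ⟩
      + 2 * (m * u + n * v) + s          ∎
      where
      open ≡-Reasoning
      cancel : ∀ m n u v s → + 2 * (m * u + n * v) - m - n + s + m + n ≡ + 2 * (m * u + n * v) + s
      cancel = solve-∀

  reflect∥-involution : FixedPointFreeInvolution (reflect∥ p m n) (Solution w)
  reflect∥-involution = record { closed = closed ; involutive = involutive ; no-fixed-point = no-fixed-point }
    where
    module _ {x : ℤ × ℤ} (sol : Solution w x) where
      u = proj₁ x
      v = proj₂ x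
      j = slope p m n 0ℤ x
      N = numerator p m n 0ℤ x
      u′ = j * m + 1ℤ - u
      v′ = j * n + 1ℤ - v

      pj≡N : + p * j ≡ N
      pj≡N = slope-exact (split m n u v w) sol
        where
        split : ∀ m n u v w → + 2 * (m * u + n * v) - m - n + 0ℤ ≡ + 2 * (m * u + n * v - w) + (+ 2 * w - (m + n))
        split = solve-∀

      weight≡ : weight p (B * m) (B * n) (u′ , v′) ≡ weight p (B * m) (B * n) x
      weight≡ = begin
        weight p (B * m) (B * n) (u′ , v′)                     ≡⟨ expand (+ p) B m n u v j ⟩
        W + (+ p * j + + 6 * B) * (j * (m * m + n * n) - N)    ≡⟨ cong (λ z → W + (+ p * j + + 6 * B) * z) (vanish pj≡N) ⟩
        W + (+ p * j + + 6 * B) * 0ℤ                           ≡⟨ drop W (+ p * j + + 6 * B) ⟩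
        W                                                      ∎
        where
        open ≡-Reasoning
        W = weight p (B * m) (B * n) x
        expand : ∀ P B m n u v j →
          P * ((j * m + 1ℤ - u) * (j * m + 1ℤ - u - 1ℤ) + (j * n + 1ℤ - v) * (j * n + 1ℤ - v - 1ℤ))
            + + 6 * (B * m * (j * m + 1ℤ - u) + B * n * (j * n + 1ℤ - v))
          ≡ P * (u * (u - 1ℤ) + v * (v - 1ℤ)) + + 6 * (B * m * u + B * n * v)
            + (P * j + + 6 * B) * (j * (m * m + n * n) - (+ 2 * (m * u + n * v) - m - n + 0ℤ))
        expand = solve-∀
        drop : ∀ a b → a + b * 0ℤ ≡ a
        drop = solve-∀

      slope≡ : slope p m n 0ℤ (u′ , v′) ≡ j
      slope≡ = cong (_/ℕ p) (begin
        numerator p m n 0ℤ (u′ , v′)               ≡⟨ expand m n u v j ⟩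
        N + + 2 * (j * (m * m + n * n) - N)        ≡⟨ cong (λ z → N + + 2 * z) (vanish pj≡N) ⟩
        N + + 2 * 0ℤ                               ≡⟨ ℤ.+-identityʳ N ⟩
        N                                          ∎)
        where
        open ≡-Reasoning
        expand : ∀ m n u v j → + 2 * (m * (j * m + 1ℤ - u) + n * (j * n + 1ℤ - v)) - m - n + 0ℤ
          ≡ + 2 * (m * u + n * v) - m - n + 0ℤ + + 2 * (j * (m * m + n * n) - (+ 2 * (m * u + n * v) - m - n + 0ℤ))
        expand = solve-∀

      reflected+ : ∀ k z → k + 1ℤ - z + z ≡ k + 1ℤ
      reflected+ = solve-∀

      closed : Solution w (u′ , v′)
      closed = proj₁ admissible , proj₂ admissible , trans weight≡ (proj₂ (proj₂ sol))
        where
        admissible = reflect∥-admissible {j} {m} {n} {u} {v} {u′} {v′} m²+n²≡2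
          (≡⇒mod (trans (slope-relation pj≡N) (ℤ.+-identityʳ _)))
          (≡⇒mod (reflected+ (j * m) u)) (≡⇒mod (reflected+ (j * n) v)) (proj₁ sol) (proj₁ (proj₂ sol))

      involutive : reflect∥ p m n (u′ , v′) ≡ x
      involutive = cong₂ _,_ (trans (cong (λ k → k * m + 1ℤ - u′) slope≡) (cancel (j * m) u))
                             (trans (cong (λ k → k * n + 1ℤ - v′) slope≡) (cancel (j * n) v))
        where
        cancel : ∀ k z → k + 1ℤ - (k + 1ℤ - z) ≡ z
        cancel = solve-∀

      no-fixed-point : (u′ , v′) ≢ x
      no-fixed-point x′≡x = reflect∥-no-fixed-point {j} {m} {n} {u} {v} m²+n²≡1
        (≡⇒mod (trans (cong (_+ u) (sym (cong proj₁ x′≡x))) (reflected+ (j * m) u)))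
        (≡⇒mod (trans (cong (_+ v) (sym (cong proj₂ x′≡x))) (reflected+ (j * n) v)))

  reflect⊥-involution : FixedPointFreeInvolution (reflect⊥ p m n b) (Solution (w - + 3 * B))
  reflect⊥-involution = record { closed = closed ; involutive = involutive ; no-fixed-point = no-fixed-point }
    where
    module _ {x : ℤ × ℤ} (sol : Solution (w - + 3 * B) x) where
      u = proj₁ x
      v = proj₂ x
      j = slope p m n (+ 6 * B) x
      N = numerator p m n (+ 6 * B) x
      u′ = u - j * m
      v′ = v - j * n

      pj≡N : + p * j ≡ N
      pj≡N = slope-exact (split m n u v w B) sol
        where
        split : ∀ m n u v w B → + 2 * (m * u + n * v) - m - n + + 6 * B
                              ≡ + 2 * (m * u + n * v - (w - + 3 * B)) + (+ 2 * w - (m + n))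
        split = solve-∀

      weight≡ : weight p (B * m) (B * n) (u′ , v′) ≡ weight p (B * m) (B * n) x
      weight≡ = begin
        weight p (B * m) (B * n) (u′ , v′)
          ≡⟨ expand (+ p) B m n u v j ⟩
        W + + p * j * (j * (m * m + n * n) - N) + + 6 * B * j * (+ p - (m * m + n * n))
          ≡⟨ cong₂ (λ y z → W + + p * j * y + + 6 * B * j * z) (vanish pj≡N) (ℤ.i≡j⇒i-j≡0 p≡m²+n²) ⟩
        W + + p * j * 0ℤ + + 6 * B * j * 0ℤ
          ≡⟨ drop W (+ p * j) (+ 6 * B * j) ⟩
        W ∎
        where
        open ≡-Reasoning
        W = weight p (B * m) (B * n) x
        expand : ∀ P B m n u v j →
          P * ((u - j * m) * (u - j * m - 1ℤ) + (v - j * n) * (v - j * n - 1ℤ))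
            + + 6 * (B * m * (u - j * m) + B * n * (v - j * n))
          ≡ P * (u * (u - 1ℤ) + v * (v - 1ℤ)) + + 6 * (B * m * u + B * n * v)
            + P * j * (j * (m * m + n * n) - (+ 2 * (m * u + n * v) - m - n + + 6 * B))
            + + 6 * B * j * (P - (m * m + n * n))
        expand = solve-∀
        drop : ∀ a b c → a + b * 0ℤ + c * 0ℤ ≡ a
        drop = solve-∀

      slope≡ : slope p m n (+ 6 * B) (u′ , v′) ≡ - j
      slope≡ = /ℕ-unique p (- j) (begin
        numerator p m n (+ 6 * B) (u′ , v′)        ≡⟨ expand m n u v j B ⟩
        - N - + 2 * (j * (m * m + n * n) - N)      ≡⟨ cong (λ z → - N - + 2 * z) (vanish pj≡N) ⟩
        - N - + 2 * 0ℤ                             ≡⟨ drop N ⟩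
        - N                                        ≡⟨ cong -_ (sym pj≡N) ⟩
        - (+ p * j)                                ≡⟨ swap (+ p) j ⟩
        - j * + p                                  ∎)
        where
        open ≡-Reasoning
        expand : ∀ m n u v j B → + 2 * (m * (u - j * m) + n * (v - j * n)) - m - n + + 6 * B
          ≡ - (+ 2 * (m * u + n * v) - m - n + + 6 * B) - + 2 * (j * (m * m + n * n) - (+ 2 * (m * u + n * v) - m - n + + 6 * B))
        expand = solve-∀
        drop : ∀ a → - a - + 2 * 0ℤ ≡ - a
        drop = solve-∀
        swap : ∀ P j → - (P * j) ≡ - j * P
        swap = solve-∀

      shifted+ : ∀ z k → z - k + k ≡ z
      shifted+ = solve-∀

      closed : Solution (w - + 3 * B) (u′ , v′)
      closed = proj₁ admissible , proj₂ admissible , trans weight≡ (proj₂ (proj₂ sol))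
        where
        six≡ : ∀ a B → a + + 6 * B ≡ a + + 2 * B * + 3
        six≡ = solve-∀
        admissible = reflect⊥-admissible {j} {m} {n} {u} {v} {u′} {v′} m²+n²≡2
          (mod-trans (≡⇒mod (trans (slope-relation pj≡N) (six≡ (+ 2 * (m * u + n * v)) B)))
                     (mod-+-multiple (+ 2 * (m * u + n * v)) (+ 2 * B)))
          (≡⇒mod (shifted+ u (j * m))) (≡⇒mod (shifted+ v (j * n))) (proj₁ sol) (proj₁ (proj₂ sol))

      involutive : reflect⊥ p m n b (u′ , v′) ≡ x
      involutive = cong₂ _,_ (trans (cong (λ k → u′ - k * m) slope≡) (cancel u j m))
                             (trans (cong (λ k → v′ - k * n) slope≡) (cancel v j n))
        where
        cancel : ∀ z j m → z - j * m - (- j) * m ≡ z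
        cancel = solve-∀

      no-fixed-point : (u′ , v′) ≢ x
      no-fixed-point x′≡x = reflect⊥-no-fixed-point {j} {m} {n} m²+n²≡1
        (mod-trans (≡⇒mod (trans (slope-relation pj≡N) (even (m * u) (n * v) B))) (mod-+-multiple 0ℤ (m * u + n * v + + 3 * B)))
        (≡⇒mod (shift-zero u (j * m) (cong proj₁ x′≡x)))
        (≡⇒mod (shift-zero v (j * n) (cong proj₂ x′≡x)))
        where
        even : ∀ y z B → + 2 * (y + z) + + 6 * B ≡ 0ℤ + (y + z + + 3 * B) * + 2
        even = solve-∀
        shift-zero : ∀ z k → z - k ≡ z → k ≡ 0ℤ
        shift-zero z k z-k≡z = trans (sym (cancel z k)) (trans (cong (_-_ z) z-k≡z) (ℤ.+-inverseʳ z))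
          where
          cancel : ∀ z k → z - (z - k) ≡ k
          cancel = solve-∀

corollary4p5 : (p : ℕ) (m n : ℤ) (b : ℕ) (w : ℤ) →
    Prime p → p % 12 ≡ 5 → + p ≡ m * m + n * n → 1 ≤ b →
    + p ∣ (+ 2 * w - (m + n)) →
    (t : ℤ) →
      (+ 2 ∣ coeffQQ p (+ b * m) (+ b * n) (+ p * t + + b * w))
      × (+ 2 ∣ coeffQQ p (+ b * m) (+ b * n) (+ p * t + + b * (w - + 3 * + b)))
corollary4p5 p m n b w p-prime p%12≡5 p≡m²+n² _ p∣2w-m-n t =
  [ (λ p∣b → p∣b⇒2∣coeffQQ p {b} p∣b m n T₁ , p∣b⇒2∣coeffQQ p {b} p∣b m n T₂)
  , (λ p∤b → involution⇒2∣coeffQQ p (+ b * m) (+ b * n) T₁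
                 (reflect∥-involution p-prime p%12≡5 {m} {n} p≡m²+n² {b} p∤b {w} p∣2w-m-n t)
             , involution⇒2∣coeffQQ p (+ b * m) (+ b * n) T₂
                 (reflect⊥-involution p-prime p%12≡5 {m} {n} p≡m²+n² {b} p∤b {w} p∣2w-m-n t))
  ]′ (toSum (p ℕ.∣? b))
  where
  instance
    p≢0 : ℕ.NonZero p
    p≢0 = prime⇒nonZero p-prime
  T₁ = + p * t + + b * w
  T₂ = + p * t + + b * (w - + 3 * + b)
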